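{- For $n\ge2$, the number of interval-closed sets of $[2]\times[n]$ is \[1+2\left(\binom{n}{2}+n\right)+\frac{n+1}{2}\binom{n+2}{3}.\] These consist of the empty set, the nonempty intervals contained entirely in $\{(1,i):i\in[n]\}$ or entirely in $\{(2,i):i\in[n]\}$, and the sets that are the union of a nonempty interval in each of these two chains.
   Context: $[n]$ is the chain $1<\cdots<n$; $[2]\times[n]$ is the Cartesian product poset with $(a,b)\le(c,d)$ iff $a\le c$ and $b\le d$. A subset $I$ of a poset is interval-closed if whenever $x,y\in I$ and $x\le z\le y$, then $z\in I$. -}

module Defs where

open import Data.Nat using (ℕ; _+_; _*_; _≥_)
open import Data.Nat.DivMod using (_/_)
open import Data.Nat.Combinatorics using (_C_)
open import Data.Fin using (Fin) renaming (_≤_ to _≤ᶠ_)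
open import Data.Fin.Subset using (Subset) renaming (_∈_ to _∈ᶠ_)
open import Data.Vec using (Vec; lookup)
open import Data.Product using (Σ; _×_; _,_)
open import Relation.Binary.PropositionalEquality using (_≡_)
open import Data.List using (List; length)
open import Data.List.Relation.Unary.Unique.Propositional using (Unique)
import Data.List.Membership.Propositional as LM
open import Function.Bundles using (_⇔_)

-- Elements of [2] × [n], with [k] modelled by Fin k (0-indexed).
Elem : ℕ → Set
Elem n = Fin 2 × Fin n

_≤ₚ_ : ∀ {n} → Elem n → Elem n → Set
(a , b) ≤ₚ (c , d) = (a ≤ᶠ c) × (b ≤ᶠ d)

-- A subset of [2] × [n]: one subset of [n] for each element of [2] (row).
SubsetP : ℕ → Set
SubsetP n = Vec (Subset n) 2

_∈ₚ_ : ∀ {n} → Elem n → SubsetP n → Set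
(i , j) ∈ₚ S = j ∈ᶠ lookup S i

IntervalClosed : ∀ {n} → SubsetP n → Set
IntervalClosed {n} S =
  (x y z : Elem n) → x ∈ₚ S → y ∈ₚ S → x ≤ₚ z → z ≤ₚ y → z ∈ₚ S

NumberOfICS : ℕ → ℕ → Set
NumberOfICS n N =
  Σ (List (SubsetP n)) λ L →
    Unique L × ((S : SubsetP n) → (S LM.∈ L) ⇔ IntervalClosed S) × (length L ≡ N)

-- 1 + 2 (C(n,2) + n) + ((n+1)/2) C(n+2,3); the last term is computed as
-- ((n+1) * C(n+2,3)) / 2, which is an exact division.
formula : ℕ → ℕ
formula n = 1 + 2 * ((n C 2) + n) + ((n + 1) * ((n + 2) C 3)) / 2

module Submission where

-- A subset of [2] × [n] is a pair of rows, A (bottom) and B (top). It is interval-closed iff both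
-- rows are convex in the chain [n] and the pair is cross-closed: whenever (1,i) and (2,j) lie in the
-- set with i ≤ j, so do (1,j) and (2,i). These conditions can be decided by recursion on the first
-- column, so the interval-closed sets are listed and counted column by column. The four choices for
-- the first column give T(n+1) = T(n) + (n+1) + (2·C(n+2,3) + n+1) + C(n+2,2): the new terms count
-- a down-closed bottom row under an empty top row, a convex bottom row under a down-closed top row
-- (cross-closed), and nested down-closed rows, each again by a column recursion. The closed formula
-- satisfies the same recurrence because 3·C(n+2,3) = n·C(n+2,2).

open import Defs
open import Data.Bool using (Bool; true; false; T; not; _∧_; if_then_else_)
open import Data.Bool.Properties using (T-∧; ∧-assoc; ∧-comm; ∧-zeroʳ; ∧-idem)
open import Data.Empty using (⊥-elim)
open import Data.Fin using (zero; suc) renaming (_≤_ to _≤ᶠ_)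
open import Data.Fin.Properties using () renaming (≤-refl to ≤ᶠ-refl; ≤-trans to ≤ᶠ-trans)
open import Data.Fin.Subset using (Subset; _⊆_; Empty) renaming (_∈_ to _∈ᶠ_)
open import Data.Fin.Subset.Properties using (drop-there)
open import Data.List using (List; []; _∷_; [_]; map; concatMap; length)
open import Data.List.Properties using (length-++; length-map; map-cong)
open import Data.List.Membership.Propositional using (_∈_)
open import Data.List.Membership.Propositional.Properties using (∈-map⁺; ∈-map⁻; ∈-concatMap⁺; ∈-concatMap⁻)
open import Data.List.Relation.Binary.Disjoint.Propositional using (Disjoint)
open import Data.List.Relation.Unary.Any using (here; there; satisfied) renaming (map to anyMap)
import Data.List.Relation.Unary.All as All
import Data.List.Relation.Unary.All.Properties as All
import Data.List.Relation.Unary.AllPairs as AllPairs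
import Data.List.Relation.Unary.AllPairs.Properties as AllPairs
open import Data.List.Relation.Unary.All using ([]; _∷_)
open import Data.List.Relation.Unary.AllPairs using ([]; _∷_)
open import Data.List.Relation.Unary.Unique.Propositional using (Unique)
import Data.List.Relation.Unary.Unique.Propositional.Properties as Unique
open import Data.Nat using (ℕ; zero; suc; _+_; _*_; _≥_; z≤n; s≤s)
open import Data.Nat.Properties using (+-identityʳ; +-comm; *-distribˡ-+)
open import Data.Nat.Combinatorics using (_C_; nC1≡n; nCk+nC[k+1]≡[n+1]C[k+1])
open import Data.Nat.DivMod using (_/_; /-congˡ; +-distrib-/-∣ʳ; m*n/n≡m)
open import Data.Nat.Divisibility using (divides)
open import Data.Nat.ListAction using (sum)
open import Data.Nat.Tactic.RingSolver using (solve-∀)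
open import Data.Product using (_×_; _,_; proj₁; proj₂) renaming (map to map-×)
open import Data.Vec using ([]; _∷_; here; there)
open import Function using (_∘_)
open import Function.Bundles using (_⇔_; mk⇔; Equivalence)
open import Function.Construct.Composition using (_⇔-∘_)
open import Relation.Binary.PropositionalEquality using (_≡_; _≢_; refl; sym; trans; cong; cong₂; module ≡-Reasoning)
open import Relation.Nullary using (¬_)

-- Interval-closed subsets of [2] × [n] as pairs of rows

DownClosed : ∀ {n} → Subset n → Set
DownClosed A = ∀ {i j} → j ∈ᶠ A → i ≤ᶠ j → i ∈ᶠ A

Convex : ∀ {n} → Subset n → Set
Convex A = ∀ {i j k} → i ∈ᶠ A → k ∈ᶠ A → i ≤ᶠ j → j ≤ᶠ k → j ∈ᶠ A

CrossClosed : ∀ {n} → Subset n → Subset n → Set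
CrossClosed A B = ∀ {i j} → i ∈ᶠ A → j ∈ᶠ B → i ≤ᶠ j → j ∈ᶠ A × i ∈ᶠ B

DownClosed⇒Convex : ∀ {n} {A : Subset n} → DownClosed A → Convex A
DownClosed⇒Convex down _ k∈A _ j≤k = down k∈A j≤k

intervalClosed⇒rows : ∀ {n} {A B : Subset n} → IntervalClosed (A ∷ B ∷ []) →
                      Convex A × Convex B × CrossClosed A B
intervalClosed⇒rows ic =
    (λ i∈A k∈A i≤j j≤k → ic (zero , _) (zero , _) (zero , _) i∈A k∈A
                             (z≤n , i≤j) (z≤n , j≤k))
  , (λ i∈B k∈B i≤j j≤k → ic (suc zero , _) (suc zero , _) (suc zero , _) i∈B k∈B
                             (s≤s z≤n , i≤j) (s≤s z≤n , j≤k))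
  , λ i∈A j∈B i≤j →
      ic (zero , _) (suc zero , _) (zero , _) i∈A j∈B (z≤n , i≤j) (z≤n , ≤ᶠ-refl) ,
      ic (zero , _) (suc zero , _) (suc zero , _) i∈A j∈B (z≤n , ≤ᶠ-refl) (s≤s z≤n , i≤j)

rows⇒intervalClosed : ∀ {n} {A B : Subset n} → Convex A → Convex B → CrossClosed A B →
                      IntervalClosed (A ∷ B ∷ [])
rows⇒intervalClosed convA _ _ (zero , _) (zero , _) (zero , _) x y (_ , i≤k) (_ , k≤j) =
  convA x y i≤k k≤j
rows⇒intervalClosed convA _ cross (zero , _) (suc zero , _) (zero , _) x y (_ , i≤k) (_ , k≤j) =
  convA x (proj₁ (cross x y (≤ᶠ-trans i≤k k≤j))) i≤k k≤j
rows⇒intervalClosed _ convB cross (zero , _) (suc zero , _) (suc zero , _) x y (_ , i≤k) (_ , k≤j) =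
  convB (proj₂ (cross x y (≤ᶠ-trans i≤k k≤j))) y i≤k k≤j
rows⇒intervalClosed _ convB _ (suc zero , _) (suc zero , _) (suc zero , _) x y (_ , i≤k) (_ , k≤j) =
  convB x y i≤k k≤j
rows⇒intervalClosed _ _ _ (_ , _) (zero , _) (suc zero , _) _ _ _ (() , _)
rows⇒intervalClosed _ _ _ (suc zero , _) (_ , _) (zero , _) _ _ (() , _) _

isEmpty : ∀ {n} → Subset n → Bool
isEmpty []      = true
isEmpty (b ∷ A) = not b ∧ isEmpty A

isDownClosed : ∀ {n} → Subset n → Bool
isDownClosed []          = true
isDownClosed (true  ∷ A) = isDownClosed A
isDownClosed (false ∷ A) = isEmpty A

isConvex : ∀ {n} → Subset n → Bool
isConvex []          = true
isConvex (true  ∷ A) = isDownClosed A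
isConvex (false ∷ A) = isConvex A

infix 7 _⊆ᵇ_
_⊆ᵇ_ : ∀ {n} → Subset n → Subset n → Bool
[]          ⊆ᵇ []      = true
(false ∷ B) ⊆ᵇ (_ ∷ A) = B ⊆ᵇ A
(true  ∷ B) ⊆ᵇ (a ∷ A) = a ∧ B ⊆ᵇ A

-- A bottom point in the first column lies below the whole top row: it forces B ⊆ A and, unless
-- B is empty, the top point of the first column.
isCrossClosed : ∀ {n} → Subset n → Subset n → Bool
isCrossClosed []          []          = true
isCrossClosed (false ∷ A) (_     ∷ B) = isCrossClosed A B
isCrossClosed (true  ∷ A) (false ∷ B) = isEmpty B ∧ isCrossClosed A B
isCrossClosed (true  ∷ A) (true  ∷ B) = B ⊆ᵇ A ∧ isCrossClosed A B

isIntervalClosed : ∀ {n} → Subset n → Subset n → Bool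
isIntervalClosed A B = isConvex A ∧ isConvex B ∧ isCrossClosed A B

T-∧⁻ : ∀ {x y} → T (x ∧ y) → T x × T y
T-∧⁻ = Equivalence.to T-∧

T-∧⁺ : ∀ {x y} → T x → T y → T (x ∧ y)
T-∧⁺ tx ty = Equivalence.from T-∧ (tx , ty)

zero∉ : ∀ {n} {A : Subset n} → ¬ zero ∈ᶠ false ∷ A
zero∉ ()

isEmpty-sound : ∀ {n} (A : Subset n) → T (isEmpty A) → Empty A
isEmpty-sound (false ∷ A) t (suc j , there j∈A) = isEmpty-sound A t (j , j∈A)

isEmpty-complete : ∀ {n} (A : Subset n) → Empty A → T (isEmpty A)
isEmpty-complete []          _     = _
isEmpty-complete (true  ∷ A) empty = empty (zero , here)
isEmpty-complete (false ∷ A) empty = isEmpty-complete A λ (j , j∈A) → empty (suc j , there j∈A)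

isDownClosed-sound : ∀ {n} (A : Subset n) → T (isDownClosed A) → DownClosed A
isDownClosed-sound (true  ∷ A) t {zero}          _           _         = here
isDownClosed-sound (true  ∷ A) t {suc i} {suc j} (there j∈A) (s≤s i≤j) =
  there (isDownClosed-sound A t j∈A i≤j)
isDownClosed-sound (false ∷ A) t {j = suc j}     (there j∈A) _         =
  ⊥-elim (isEmpty-sound A t (j , j∈A))

isDownClosed-complete : ∀ {n} (A : Subset n) → DownClosed A → T (isDownClosed A)
isDownClosed-complete []          _    = _
isDownClosed-complete (true  ∷ A) down =
  isDownClosed-complete A λ j∈A i≤j → drop-there (down (there j∈A) (s≤s i≤j))
isDownClosed-complete (false ∷ A) down =
  isEmpty-complete A λ (_ , j∈A) → zero∉ (down (there j∈A) z≤n)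

isConvex-sound : ∀ {n} (A : Subset n) → T (isConvex A) → Convex A
isConvex-sound (true  ∷ A) t = DownClosed⇒Convex (isDownClosed-sound (true ∷ A) t)
isConvex-sound (false ∷ A) t {suc _} {suc _} {suc _} (there i∈A) (there k∈A) (s≤s i≤j) (s≤s j≤k) =
  there (isConvex-sound A t i∈A k∈A i≤j j≤k)

isConvex-complete : ∀ {n} (A : Subset n) → Convex A → T (isConvex A)
isConvex-complete []          _      = _
isConvex-complete (true  ∷ A) convex =
  isDownClosed-complete (true ∷ A) λ j∈A i≤j → convex here j∈A z≤n i≤j
isConvex-complete (false ∷ A) convex = isConvex-complete A λ i∈A k∈A i≤j j≤k →
  drop-there (convex (there i∈A) (there k∈A) (s≤s i≤j) (s≤s j≤k))

⊆ᵇ-sound : ∀ {n} (B A : Subset n) → T (B ⊆ᵇ A) → B ⊆ A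
⊆ᵇ-sound (true  ∷ B) (true ∷ A) t here        = here
⊆ᵇ-sound (true  ∷ B) (true ∷ A) t (there j∈B) = there (⊆ᵇ-sound B A t j∈B)
⊆ᵇ-sound (false ∷ B) (_    ∷ A) t (there j∈B) = there (⊆ᵇ-sound B A t j∈B)

⊆ᵇ-complete : ∀ {n} (B A : Subset n) → B ⊆ A → T (B ⊆ᵇ A)
⊆ᵇ-complete []          []      _   = _
⊆ᵇ-complete (false ∷ B) (_ ∷ A) B⊆A = ⊆ᵇ-complete B A (drop-there ∘ B⊆A ∘ there)
⊆ᵇ-complete (true  ∷ B) (a ∷ A) B⊆A with B⊆A here
... | here = ⊆ᵇ-complete B A (drop-there ∘ B⊆A ∘ there)

CrossClosed-tail : ∀ {n p q} {A B : Subset n} → CrossClosed (p ∷ A) (q ∷ B) → CrossClosed A B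
CrossClosed-tail cross i∈A j∈B i≤j =
  map-× drop-there drop-there (cross (there i∈A) (there j∈B) (s≤s i≤j))

isCrossClosed-tail : ∀ {n} p q (A B : Subset n) →
                     T (isCrossClosed (p ∷ A) (q ∷ B)) → T (isCrossClosed A B)
isCrossClosed-tail false _     A B t = t
isCrossClosed-tail true  false A B t = proj₂ (T-∧⁻ t)
isCrossClosed-tail true  true  A B t = proj₂ (T-∧⁻ {B ⊆ᵇ A} t)

isCrossClosed-sound : ∀ {n} (A B : Subset n) → T (isCrossClosed A B) → CrossClosed A B
isCrossClosed-sound (p ∷ A) (q ∷ B) t {suc _} {suc _} (there i∈A) (there j∈B) (s≤s i≤j) =
  map-× there there (isCrossClosed-sound A B (isCrossClosed-tail p q A B t) i∈A j∈B i≤j)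
isCrossClosed-sound (true ∷ A) (true  ∷ B) t {zero} {zero}  here _           _ = here , here
isCrossClosed-sound (true ∷ A) (true  ∷ B) t {zero} {suc j} here (there j∈B) _ =
  there (⊆ᵇ-sound B A (proj₁ (T-∧⁻ {B ⊆ᵇ A} t)) j∈B) , here
isCrossClosed-sound (true ∷ A) (false ∷ B) t {zero} {suc j} here (there j∈B) _ =
  ⊥-elim (isEmpty-sound B (proj₁ (T-∧⁻ t)) (j , j∈B))

isCrossClosed-complete : ∀ {n} (A B : Subset n) → CrossClosed A B → T (isCrossClosed A B)
isCrossClosed-complete []          []          _     = _
isCrossClosed-complete (false ∷ A) (_     ∷ B) cross =
  isCrossClosed-complete A B (CrossClosed-tail cross)
isCrossClosed-complete (true  ∷ A) (false ∷ B) cross =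
  T-∧⁺ (isEmpty-complete B λ (_ , j∈B) → zero∉ (proj₂ (cross here (there j∈B) z≤n)))
       (isCrossClosed-complete A B (CrossClosed-tail cross))
isCrossClosed-complete (true  ∷ A) (true  ∷ B) cross =
  T-∧⁺ (⊆ᵇ-complete B A λ j∈B → drop-there (proj₁ (cross here (there j∈B) z≤n)))
       (isCrossClosed-complete A B (CrossClosed-tail cross))

isIntervalClosed-correct : ∀ {n} (A B : Subset n) →
                           T (isIntervalClosed A B) ⇔ IntervalClosed (A ∷ B ∷ [])
isIntervalClosed-correct A B = mk⇔ sound complete
  where
  sound : T (isIntervalClosed A B) → IntervalClosed (A ∷ B ∷ [])
  sound t with T-∧⁻ {isConvex A} t
  ... | convA , t′ with T-∧⁻ {isConvex B} t′
  ... | convB , cross = rows⇒intervalClosed (isConvex-sound A convA) (isConvex-sound B convB)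
                                            (isCrossClosed-sound A B cross)
  complete : IntervalClosed (A ∷ B ∷ []) → T (isIntervalClosed A B)
  complete ic with intervalClosed⇒rows ic
  ... | convA , convB , cross = T-∧⁺ (isConvex-complete A convA)
                                     (T-∧⁺ (isConvex-complete B convB) (isCrossClosed-complete A B cross))

-- Enumerating and counting pairs of rows column by column

Column : Set
Column = Bool × Bool

columns : List Column
columns = (false , false) ∷ (true , false) ∷ (false , true) ∷ (true , true) ∷ []

∈-columns : ∀ c → c ∈ columns
∈-columns (false , false) = here refl
∈-columns (true  , false) = there (here refl)
∈-columns (false , true)  = there (there (here refl))
∈-columns (true  , true)  = there (there (there (here refl)))

columns-unique : Unique columns
columns-unique =
  ((λ ()) ∷ (λ ()) ∷ (λ ()) ∷ []) ∷ ((λ ()) ∷ (λ ()) ∷ []) ∷ ((λ ()) ∷ []) ∷ [] ∷ []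

_◂_ : ∀ {n} → Column → SubsetP n → SubsetP (suc n)
(p , q) ◂ (A ∷ B ∷ []) = (p ∷ A) ∷ (q ∷ B) ∷ []

◂-injective : ∀ {n} {c d : Column} {S R : SubsetP n} → c ◂ S ≡ d ◂ R → c ≡ d × S ≡ R
◂-injective {c = _ , _} {_ , _} {_ ∷ _ ∷ []} {_ ∷ _ ∷ []} refl = refl , refl

Pred₂ : ℕ → Set
Pred₂ n = Subset n → Subset n → Bool

holds : ∀ {n} → Pred₂ n → SubsetP n → Bool
holds f (A ∷ B ∷ []) = f A B

afterColumn : ∀ {n} → Column → Pred₂ (suc n) → Pred₂ n
afterColumn (p , q) f A B = f (p ∷ A) (q ∷ B)

enumerate : ∀ {n} → Pred₂ n → List (SubsetP n)
columnBlock : ∀ {n} → Pred₂ (suc n) → Column → List (SubsetP (suc n))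

enumerate {zero}  f = if f [] [] then [ [] ∷ [] ∷ [] ] else []
enumerate {suc n} f = concatMap (columnBlock f) columns

columnBlock f c = map (c ◂_) (enumerate (afterColumn c f))

count : ∀ {n} → Pred₂ n → ℕ
count {zero}  f = if f [] [] then 1 else 0
count {suc n} f = sum (map (λ c → count (afterColumn c f)) columns)

∈-enumerate⁺ : ∀ {n} (f : Pred₂ n) S → T (holds f S) → S ∈ enumerate f
∈-enumerate⁺ {zero} f ([] ∷ [] ∷ []) t with f [] []
... | true = here refl
∈-enumerate⁺ {suc n} f ((p ∷ A) ∷ (q ∷ B) ∷ []) t =
  ∈-concatMap⁺ (columnBlock f) (anyMap (λ { refl → ∈-map⁺ _ S∈block }) (∈-columns (p , q)))
  where S∈block = ∈-enumerate⁺ (afterColumn (p , q) f) (A ∷ B ∷ []) t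

∈-enumerate⁻ : ∀ {n} (f : Pred₂ n) S → S ∈ enumerate f → T (holds f S)
∈-enumerate⁻ {zero} f ([] ∷ [] ∷ []) S∈ with f [] []
... | true = _
∈-enumerate⁻ {suc n} f S S∈ with satisfied (∈-concatMap⁻ (columnBlock f) {xs = columns} S∈)
... | c , S∈block with ∈-map⁻ (c ◂_) S∈block
... | A ∷ B ∷ [] , R∈ , refl = ∈-enumerate⁻ (afterColumn c f) (A ∷ B ∷ []) R∈

∈-enumerate : ∀ {n} (f : Pred₂ n) S → S ∈ enumerate f ⇔ T (holds f S)
∈-enumerate f S = mk⇔ (∈-enumerate⁻ f S) (∈-enumerate⁺ f S)

enumerate-unique : ∀ {n} (f : Pred₂ n) → Unique (enumerate f)
enumerate-unique {zero}  f with f [] []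
... | true  = [] ∷ []
... | false = []
enumerate-unique {suc n} f =
  Unique.concat⁺ (All.map⁺ (All.universal blockUnique columns))
                 (AllPairs.map⁺ (AllPairs.map blocksDisjoint columns-unique))
  where
  blockUnique : ∀ c → Unique (columnBlock f c)
  blockUnique c = Unique.map⁺ (proj₂ ∘ ◂-injective) (enumerate-unique (afterColumn c f))
  blocksDisjoint : ∀ {c d} → c ≢ d → Disjoint (columnBlock f c) (columnBlock f d)
  blocksDisjoint c≢d (S∈c , S∈d) with ∈-map⁻ _ S∈c | ∈-map⁻ _ S∈d
  ... | _ , _ , refl | _ , _ , eq = c≢d (proj₁ (◂-injective eq))

length-enumerate : ∀ {n} (f : Pred₂ n) → length (enumerate f) ≡ count f
length-enumerate {zero}  f with f [] []
... | true  = refl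
... | false = refl
length-enumerate {suc n} f = lengthBlocks columns
  where
  lengthBlocks : ∀ cs → length (concatMap (columnBlock f) cs)
                        ≡ sum (map (λ c → count (afterColumn c f)) cs)
  lengthBlocks []       = refl
  lengthBlocks (c ∷ cs) = trans (length-++ (columnBlock f c) {concatMap (columnBlock f) cs})
    (cong₂ _+_ (trans (length-map (c ◂_) (enumerate (afterColumn c f)))
                      (length-enumerate (afterColumn c f)))
               (lengthBlocks cs))

count-cong : ∀ {n} {f g : Pred₂ n} → (∀ A B → f A B ≡ g A B) → count f ≡ count g
count-cong {zero}  f≗g = cong (λ b → if b then 1 else 0) (f≗g [] [])
count-cong {suc n} f≗g =
  cong sum (map-cong (λ { (p , q) → count-cong λ A B → f≗g (p ∷ A) (q ∷ B) }) columns)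

count-suc : ∀ {n} (f : Pred₂ (suc n)) {a b c d e} →
  count (afterColumn (false , false) f) ≡ a → count (afterColumn (true , false) f) ≡ b →
  count (afterColumn (false , true) f) ≡ c → count (afterColumn (true , true) f) ≡ d →
  a + (b + (c + d)) ≡ e → count f ≡ e
count-suc f {a} {b} {c} {d} refl refl refl refl sum≡e =
  trans (cong (λ x → a + (b + (c + x))) (+-identityʳ d)) sum≡e

count-none : ∀ {n} (f : Pred₂ n) → (∀ A B → f A B ≡ false) → count f ≡ 0
count-none {zero}  f none = cong (λ b → if b then 1 else 0) (none [] [])
count-none {suc n} f none = count-suc f (after _) (after _) (after _) (after _) refl
  where
  after : ∀ c → count (afterColumn c f) ≡ 0
  after (p , q) = count-none (afterColumn (p , q) f) λ A B → none (p ∷ A) (q ∷ B)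

-- Binomial identities

n+nC2≡[1+n]C2 : ∀ n → n + n C 2 ≡ suc n C 2
n+nC2≡[1+n]C2 n = trans (cong (_+ n C 2) (sym (nC1≡n n))) (nCk+nC[k+1]≡[n+1]C[k+1] n 1)

[2+n]C2+[2+n]C3≡[3+n]C3 : ∀ n → (2 + n) C 2 + (2 + n) C 3 ≡ (3 + n) C 3
[2+n]C2+[2+n]C3≡[3+n]C3 n = nCk+nC[k+1]≡[n+1]C[k+1] (2 + n) 2

2*[1+n]C2≡[1+n]*n : ∀ n → 2 * (suc n C 2) ≡ suc n * n
2*[1+n]C2≡[1+n]*n zero    = refl
2*[1+n]C2≡[1+n]*n (suc n) = begin
  2 * ((2 + n) C 2)              ≡⟨ cong (2 *_) (sym (n+nC2≡[1+n]C2 (suc n))) ⟩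
  2 * (suc n + suc n C 2)        ≡⟨ *-distribˡ-+ 2 (suc n) (suc n C 2) ⟩
  2 * suc n + 2 * (suc n C 2)    ≡⟨ cong (2 * suc n +_) (2*[1+n]C2≡[1+n]*n n) ⟩
  2 * suc n + suc n * n          ≡⟨ factor n ⟩
  (2 + n) * suc n                ∎
  where
  open ≡-Reasoning
  factor : ∀ n → 2 * suc n + suc n * n ≡ (2 + n) * suc n
  factor = solve-∀

3*[2+n]C3≡n*[2+n]C2 : ∀ n → 3 * ((2 + n) C 3) ≡ n * ((2 + n) C 2)
3*[2+n]C3≡n*[2+n]C2 zero    = refl
3*[2+n]C3≡n*[2+n]C2 (suc n) = begin
  3 * ((3 + n) C 3)              ≡⟨ cong (3 *_) (sym ([2+n]C2+[2+n]C3≡[3+n]C3 n)) ⟩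
  3 * (c₂ + c₃)                  ≡⟨ *-distribˡ-+ 3 c₂ c₃ ⟩
  3 * c₂ + 3 * c₃                ≡⟨ cong (3 * c₂ +_) (3*[2+n]C3≡n*[2+n]C2 n) ⟩
  3 * c₂ + n * c₂                ≡⟨ split n c₂ ⟩
  2 * c₂ + suc n * c₂            ≡⟨ cong (_+ suc n * c₂) (2*[1+n]C2≡[1+n]*n (suc n)) ⟩
  (2 + n) * suc n + suc n * c₂   ≡⟨ factor n c₂ ⟩
  suc n * ((2 + n) + c₂)         ≡⟨ cong (suc n *_) (n+nC2≡[1+n]C2 (2 + n)) ⟩
  suc n * ((3 + n) C 2)          ∎
  where
  open ≡-Reasoning
  c₂ = (2 + n) C 2
  c₃ = (2 + n) C 3
  split : ∀ n c → 3 * c + n * c ≡ 2 * c + suc n * c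
  split = solve-∀
  factor : ∀ n c → (2 + n) * suc n + suc n * c ≡ suc n * ((2 + n) + c)
  factor = solve-∀

formula-suc : ∀ n →
  formula (suc n) ≡ formula n + (suc n + ((2 * ((2 + n) C 3) + suc n) + (2 + n) C 2))
formula-suc n = begin
  1 + 2 * (suc n C 2 + suc n) + (suc (n + 1) * (suc (n + 2) C 3)) / 2
    ≡⟨ cong₂ (λ a h → 1 + 2 * (a + suc n) + h) (sym (n+nC2≡[1+n]C2 n)) half-suc ⟩
  1 + 2 * ((n + n C 2) + suc n) + (t / 2 + (2 * c₃ + c₂))
    ≡⟨ rearrange n (n C 2) (t / 2) c₃ c₂ ⟩
  formula n + (suc n + ((2 * c₃ + suc n) + c₂))
    ∎
  where
  open ≡-Reasoning
  c₂ = (2 + n) C 2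
  c₃ = (2 + n) C 3
  t = (n + 1) * ((n + 2) C 3)
  rearrange : ∀ n a h c₃ c₂ → 1 + 2 * ((n + a) + suc n) + (h + (2 * c₃ + c₂))
                             ≡ (1 + 2 * (a + n) + h) + (suc n + ((2 * c₃ + suc n) + c₂))
  rearrange = solve-∀
  expand : ∀ n c₂ c₃ → (2 + n) * (c₂ + c₃) ≡ n * c₂ + (2 * c₂ + (2 + n) * c₃)
  expand = solve-∀
  collect : ∀ n c₂ c₃ → 3 * c₃ + (2 * c₂ + (2 + n) * c₃) ≡ suc n * c₃ + (2 * c₃ + c₂) * 2
  collect = solve-∀
  doubled : suc (n + 1) * (suc (n + 2) C 3) ≡ t + (2 * c₃ + c₂) * 2
  doubled = begin
    suc (n + 1) * (suc (n + 2) C 3)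
      ≡⟨ cong₂ (λ a b → suc a * (suc b C 3)) (+-comm n 1) (+-comm n 2) ⟩
    (2 + n) * ((3 + n) C 3)
      ≡⟨ cong ((2 + n) *_) (sym ([2+n]C2+[2+n]C3≡[3+n]C3 n)) ⟩
    (2 + n) * (c₂ + c₃)
      ≡⟨ expand n c₂ c₃ ⟩
    n * c₂ + (2 * c₂ + (2 + n) * c₃)
      ≡⟨ cong (_+ (2 * c₂ + (2 + n) * c₃)) (sym (3*[2+n]C3≡n*[2+n]C2 n)) ⟩
    3 * c₃ + (2 * c₂ + (2 + n) * c₃)
      ≡⟨ collect n c₂ c₃ ⟩
    suc n * c₃ + (2 * c₃ + c₂) * 2
      ≡⟨ cong₂ (λ a b → a * (b C 3) + (2 * c₃ + c₂) * 2) (+-comm 1 n) (+-comm 2 n) ⟩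
    t + (2 * c₃ + c₂) * 2
      ∎
  half-suc : (suc (n + 1) * (suc (n + 2) C 3)) / 2 ≡ t / 2 + (2 * c₃ + c₂)
  half-suc = begin
    (suc (n + 1) * (suc (n + 2) C 3)) / 2  ≡⟨ /-congˡ doubled ⟩
    (t + (2 * c₃ + c₂) * 2) / 2            ≡⟨ +-distrib-/-∣ʳ t (divides (2 * c₃ + c₂) refl) ⟩
    t / 2 + ((2 * c₃ + c₂) * 2) / 2        ≡⟨ cong (t / 2 +_) (m*n/n≡m (2 * c₃ + c₂) 2) ⟩
    t / 2 + (2 * c₃ + c₂)                  ∎

∧-impliedʳ : ∀ x {y} → (T x → T y) → x ∧ y ≡ x
∧-impliedʳ false         _   = refl
∧-impliedʳ true  {true}  _   = refl
∧-impliedʳ true  {false} x⇒y = ⊥-elim (x⇒y _)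

isEmpty∧isCrossClosed : ∀ {n} (A B : Subset n) → isEmpty B ∧ isCrossClosed A B ≡ isEmpty B
isEmpty∧isCrossClosed A B = ∧-impliedʳ (isEmpty B) λ empty →
  isCrossClosed-complete A B λ _ j∈B _ → ⊥-elim (isEmpty-sound B empty (_ , j∈B))

isEmpty∧⊆ᵇ : ∀ {n} (A B : Subset n) → isEmpty B ∧ B ⊆ᵇ A ≡ isEmpty B
isEmpty∧⊆ᵇ A B = ∧-impliedʳ (isEmpty B) λ empty →
  ⊆ᵇ-complete B A λ j∈B → ⊥-elim (isEmpty-sound B empty (_ , j∈B))

isConvex∧isEmpty : ∀ {n} (B : Subset n) → isConvex B ∧ isEmpty B ≡ isEmpty B
isConvex∧isEmpty B = trans (∧-comm (isConvex B) (isEmpty B)) (∧-impliedʳ (isEmpty B) λ empty →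
  isConvex-complete B λ i∈B _ _ _ → ⊥-elim (isEmpty-sound B empty (_ , i∈B)))

isDownClosed∧⊆ᵇ∧isCrossClosed : ∀ {n} (A B : Subset n) →
  isDownClosed B ∧ B ⊆ᵇ A ∧ isCrossClosed A B ≡ isDownClosed B ∧ B ⊆ᵇ A
isDownClosed∧⊆ᵇ∧isCrossClosed A B =
  trans (sym (∧-assoc (isDownClosed B) (B ⊆ᵇ A) _)) (∧-impliedʳ (isDownClosed B ∧ B ⊆ᵇ A) λ t →
    let down , B⊆A = T-∧⁻ {isDownClosed B} t
    in isCrossClosed-complete A B λ _ j∈B i≤j →
         ⊆ᵇ-sound B A B⊆A j∈B , isDownClosed-sound B down j∈B i≤j)

bothEmpty downClosedBottom convexBottom nestedDownClosed downClosedTop : ∀ {n} → Pred₂ n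
bothEmpty        A B = isEmpty A ∧ isEmpty B
downClosedBottom A B = isDownClosed A ∧ isEmpty B
convexBottom     A B = isConvex A ∧ isEmpty B
nestedDownClosed A B = isDownClosed A ∧ isDownClosed B ∧ B ⊆ᵇ A
downClosedTop    A B = isConvex A ∧ isDownClosed B ∧ isCrossClosed A B

count-bothEmpty : ∀ n → count {n} bothEmpty ≡ 1
count-bothEmpty zero    = refl
count-bothEmpty (suc n) =
  count-suc {n} bothEmpty
    (count-bothEmpty n)
    (count-none {n} _ λ _ _ → refl)
    (count-none {n} _ λ A _ → ∧-zeroʳ (isEmpty A))
    (count-none {n} _ λ _ _ → refl)
    refl

count-downClosedBottom : ∀ n → count {n} downClosedBottom ≡ suc n
count-downClosedBottom zero    = refl
count-downClosedBottom (suc n) =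
  count-suc {n} downClosedBottom
    (count-bothEmpty n)
    (count-downClosedBottom n)
    (count-none {n} _ λ A _ → ∧-zeroʳ (isEmpty A))
    (count-none {n} _ λ A _ → ∧-zeroʳ (isDownClosed A))
    (cong (2 +_) (+-identityʳ n))

count-nestedDownClosed : ∀ n → count {n} nestedDownClosed ≡ (2 + n) C 2
count-nestedDownClosed zero    = refl
count-nestedDownClosed (suc n) =
  count-suc {n} nestedDownClosed
    (trans (count-cong {n} λ A B → cong (isEmpty A ∧_) (isEmpty∧⊆ᵇ A B)) (count-bothEmpty n))
    (trans (count-cong {n} λ A B → cong (isDownClosed A ∧_) (isEmpty∧⊆ᵇ A B))
           (count-downClosedBottom n))
    (count-none {n} _ λ A B →
       trans (cong (isEmpty A ∧_) (∧-zeroʳ (isDownClosed B))) (∧-zeroʳ (isEmpty A)))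
    (count-nestedDownClosed n)
    (n+nC2≡[1+n]C2 (2 + n))

count-convexBottom : ∀ n → count {n} convexBottom ≡ suc (suc n C 2)
count-convexBottom zero    = refl
count-convexBottom (suc n) =
  count-suc {n} convexBottom
    (count-convexBottom n)
    (count-downClosedBottom n)
    (count-none {n} _ λ A _ → ∧-zeroʳ (isConvex A))
    (count-none {n} _ λ A _ → ∧-zeroʳ (isDownClosed A))
    (cong suc (trans (rearrange (suc n C 2) (suc n)) (n+nC2≡[1+n]C2 (suc n))))
  where
  rearrange : ∀ a m → a + (m + 0) ≡ m + a
  rearrange = solve-∀

count-nestedDownClosed∧isCrossClosed : ∀ n →
  count {n} (λ A B → isDownClosed A ∧ isDownClosed B ∧ B ⊆ᵇ A ∧ isCrossClosed A B) ≡ (2 + n) C 2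
count-nestedDownClosed∧isCrossClosed n =
  trans (count-cong {n} λ A B → cong (isDownClosed A ∧_) (isDownClosed∧⊆ᵇ∧isCrossClosed A B))
        (count-nestedDownClosed n)

count-downClosedTop : ∀ n → count {n} downClosedTop ≡ 2 * ((2 + n) C 3) + suc n
count-downClosedTop zero    = refl
count-downClosedTop (suc n) =
  count-suc {n} downClosedTop
    (trans (count-cong {n} λ A B → cong (isConvex A ∧_) (isEmpty∧isCrossClosed A B))
           (count-convexBottom n))
    (trans (count-cong {n} λ A B →
              cong (isDownClosed A ∧_) (trans (cong (isEmpty B ∧_) (isEmpty∧isCrossClosed A B))
                                              (∧-idem _)))
           (count-downClosedBottom n))
    (count-downClosedTop n)
    (count-nestedDownClosed∧isCrossClosed n)
    (begin
      suc c₁ + (suc n + ((2 * c₃ + suc n) + c₂))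
        ≡⟨ cong (λ x → suc c₁ + (suc n + ((2 * c₃ + suc n) + x))) (sym (n+nC2≡[1+n]C2 (suc n))) ⟩
      suc c₁ + (suc n + ((2 * c₃ + suc n) + (suc n + c₁)))
        ≡⟨ rearrange n c₁ c₃ ⟩
      2 * ((suc n + c₁) + c₃) + suc (suc n)
        ≡⟨ cong (λ x → 2 * (x + c₃) + suc (suc n)) (n+nC2≡[1+n]C2 (suc n)) ⟩
      2 * (c₂ + c₃) + suc (suc n)
        ≡⟨ cong (λ x → 2 * x + suc (suc n)) ([2+n]C2+[2+n]C3≡[3+n]C3 n) ⟩
      2 * ((3 + n) C 3) + suc (suc n)
        ∎)
  where
  open ≡-Reasoning
  c₁ = suc n C 2
  c₂ = (2 + n) C 2
  c₃ = (2 + n) C 3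
  rearrange : ∀ n c₁ c₃ → suc c₁ + (suc n + ((2 * c₃ + suc n) + (suc n + c₁)))
                          ≡ 2 * ((suc n + c₁) + c₃) + suc (suc n)
  rearrange = solve-∀

count-intervalClosed : ∀ n → count {n} isIntervalClosed ≡ formula n
count-intervalClosed zero    = refl
count-intervalClosed (suc n) =
  count-suc {n} isIntervalClosed
    (count-intervalClosed n)
    (trans (count-cong {n} λ A B →
              cong (isDownClosed A ∧_) (trans (cong (isConvex B ∧_) (isEmpty∧isCrossClosed A B))
                                              (isConvex∧isEmpty B)))
           (count-downClosedBottom n))
    (count-downClosedTop n)
    (count-nestedDownClosed∧isCrossClosed n)
    (sym (formula-suc n))

-- The count is valid for every n.
theorem4p2 : (n : ℕ) → n ≥ 2 → NumberOfICS n (formula n)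
theorem4p2 n _ =
    enumerate isIntervalClosed
  , enumerate-unique isIntervalClosed
  , (λ { S@(A ∷ B ∷ []) → isIntervalClosed-correct A B ⇔-∘ ∈-enumerate isIntervalClosed S })
  , trans (length-enumerate {n} isIntervalClosed) (count-intervalClosed n)
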